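{- For every $k\ge1$ and every metric space $M$, the online algorithm HANDICAP for the $k$-server problem is $k$-competitive against any adversary which can have at most one open server: there is a constant $K$ (depending only on the initial configurations) such that for every request sequence served by such an adversary, $\mathrm{cost}_{\mathrm{HANDICAP}}\le k\cdot \mathrm{cost}_{adv}+K$.
   Context: The $k$-server problem: $k$ mobile servers sit at points of a metric space $(M,d)$ (pseudo-metrics allowed); at each step a request point $r\in M$ is given and some server must move to $r$; cost is total distance traveled. An online algorithm decides without knowledge of future requests; the adversary generates the requests and also serves them with its own $k$ servers. HANDICAP maintains real numbers $E_1,\dots,E_k$ (initially $0$), one per algorithm server $s_1,\dots,s_k$; on request $r$ it chooses an index $i$ minimizing $E_i+d(s_i,r)$ (ties arbitrary), then for every $j$ replaces $E_j$ by $E_j+\tfrac12\bigl(d(r,s_i)+d(r,s_j)-d(s_i,s_j)\bigr)$, and moves $s_i$ to $r$ (no other server moves). With the adversary's servers $a_1,\dots,a_k$ indexed so that $s_i\leftrightarrow a_i$ is a minimum-cost matching, an adversary server $a_i$ is open if $a_i\ne s_i$; "at most one open server" means that at all times at most one adversary server is open (e.g. the lazy adversary, which only requests points occupied by its own servers but not by the algorithm's). -}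

module Defs where

open import Level using (0ℓ)
open import Data.Nat using (ℕ; zero; suc)
import Data.Nat as ℕ
open import Data.Fin using (Fin)
import Data.Fin as Fin
open import Data.Fin.Permutation using (Permutation′; _⟨$⟩ʳ_)
open import Data.Product using (Σ; ∃; _×_)
open import Relation.Nullary using (¬_)
open import Relation.Binary.PropositionalEquality using (_≡_; _≢_)
open import Algebra.Structures using (IsCommutativeRing)
open import Relation.Binary.Structures using (IsTotalOrder)

-- Ordered fields (the stdlib has no real numbers; ℝ is an ordered field,
-- so a statement over every ordered field covers the real-valued case).

record OrderedField : Set₁ where
  infix  4 _≈_ _≤_
  infixl 6 _+_ _-_
  infixl 7 _*_
  field
    Carrier : Set
    _≈_ _≤_ : Carrier → Carrier → Set
    _+_ _*_ : Carrier → Carrier → Carrier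
    -_      : Carrier → Carrier
    0# 1#   : Carrier
    isCommutativeRing : IsCommutativeRing _≈_ _+_ _*_ -_ 0# 1#
    isTotalOrder      : IsTotalOrder _≈_ _≤_
    0≉1     : ¬ (0# ≈ 1#)
    inverse : ∀ x → ¬ (x ≈ 0#) → Σ Carrier (λ y → x * y ≈ 1#)
    +-mono-≤ : ∀ {x y} z → x ≤ y → x + z ≤ y + z
    *-nonneg : ∀ {x y} → 0# ≤ x → 0# ≤ y → 0# ≤ x * y

  _-_ : Carrier → Carrier → Carrier
  x - y = x + (- y)

record PseudoMetric (F : OrderedField) : Set₁ where
  open OrderedField F
  field
    Point : Set
    d     : Point → Point → Carrier
    d-refl : ∀ x → d x x ≈ 0#
    d-sym  : ∀ x y → d x y ≈ d y x
    d-tri  : ∀ x y z → d x z ≤ d x y + d y z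

module KServer (F : OrderedField) (M : PseudoMetric F) (k : ℕ) where
  open OrderedField F
  open PseudoMetric M

  Config : Set
  Config = Fin k → Point

  sumFin : ∀ n → (Fin n → Carrier) → Carrier
  sumFin zero    f = 0#
  sumFin (suc n) f = f Fin.zero + sumFin n (λ i → f (Fin.suc i))

  sumℕ : ℕ → (ℕ → Carrier) → Carrier
  sumℕ zero    f = 0#
  sumℕ (suc n) f = sumℕ n f + f n

  _·_ : ℕ → Carrier → Carrier
  zero  · x = 0#
  suc m · x = x + m · x

  moveCost : Config → Config → Carrier
  moveCost c c' = sumFin k (λ j → d (c j) (c' j))

  matchCost : Config → Config → Carrier
  matchCost s b = sumFin k (λ j → d (s j) (b j))

  MinCostMatching : Config → Config → Set
  MinCostMatching s b =
    ∀ (σ : Permutation′ k) → matchCost s b ≤ matchCost s (λ j → b (σ ⟨$⟩ʳ j))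

  -- with the adversary servers re-indexed (by π) so that s i ↔ a (π i)
  -- is a minimum-cost matching, at most one adversary server is open
  AtMostOneOpen : Config → Config → Set
  AtMostOneOpen s a = ∃ λ (π : Permutation′ k) →
      MinCostMatching s (λ j → a (π ⟨$⟩ʳ j))
    × (∀ i j → a (π ⟨$⟩ʳ i) ≢ s i → a (π ⟨$⟩ʳ j) ≢ s j → i ≡ j)

  -- The update E'_j = E_j + ½(d(r,s_i)+d(r,s_j)-d(s_i,s_j))
  -- is written multiplied by 2 (equivalent in an ordered field).
  HandicapStep : Config → (Fin k → Carrier) → Point → Fin k
               → Config → (Fin k → Carrier) → Set
  HandicapStep s E r i s' E' =
      (∀ j → E i + d (s i) r ≤ E j + d (s j) r)
    × (∀ j → E' j + E' j ≈ (E j + E j) + (d r (s i) + d r (s j) - d (s i) (s j)))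
    × s' i ≡ r
    × (∀ j → j ≢ i → s' j ≡ s j)

  record Run (n : ℕ) (s₀ a₀ : Config) : Set where
    field
      r : ℕ → Point
      s : ℕ → Config
      E : ℕ → Fin k → Carrier
      c : ℕ → Fin k
      a : ℕ → Config
      s-init : ∀ j → s 0 j ≡ s₀ j
      a-init : ∀ j → a 0 j ≡ a₀ j
      E-init : ∀ j → E 0 j ≈ 0#
      handicap : ∀ t → t ℕ.< n → HandicapStep (s t) (E t) (r t) (c t) (s (suc t)) (E (suc t))
      adv-serves : ∀ t → t ℕ.< n → ∃ λ j → a (suc t) j ≡ r t
      -- at all times at most one open server: after every step, initially,
      -- and in the intermediate moment (adversary moved, algorithm not yet)
      open-after : ∀ t → t ℕ.≤ n → AtMostOneOpen (s t) (a t)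
      open-between : ∀ t → t ℕ.< n → AtMostOneOpen (s t) (a (suc t))

    costAlg : Carrier
    costAlg = sumℕ n (λ t → moveCost (s t) (s (suc t)))

    costAdv : Carrier
    costAdv = sumℕ n (λ t → moveCost (a t) (a (suc t)))

-- Write e = 2E for the doubled handicaps, H_c(x) = Σ_l d(x, c_l) for a configuration c, and
-- gap(x) = H_a(x) - H_s(x).  For every index m the potential
--   Φ_m = Σ_{j,l} d(s_j, s_l) - 2 Σ_j e_j + 2k (e_m + gap(s_m))
-- satisfies 2 cost_alg + Φ_m ≤ 2 (k cost_adv + K) at all times, where
-- K = Σ_{j,l} d(s⁰_j, s⁰_l) + k Σ_j d(s⁰_j, a⁰_j) bounds the initial potentials.  An adversary
-- move of cost v raises every Φ_m by at most 2kv.  When HANDICAP moves s_i to the request r at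
-- cost c, each Φ_m with m ≠ i drops by exactly 2c, and Φ_i + 2c after the move is at most Φ_o
-- before it, where o is the server matched to the adversary server on r: with at most one
-- open server, gap(s_o) = gap(r) + 2 d(s_o, r), and the greedy choice of i gives
-- e_i + 2 d(s_i, r) ≤ e_o + 2 d(s_o, r).  Summing over m cancels the handicaps and leaves
-- Σ_m Φ_m = 2k Σ_m H_a(s_m) - k Σ_{j,l} d(s_j, s_l) ≥ 0 (triangle inequality through each
-- adversary server), whence cost_alg ≤ k cost_adv + K.
-- Equality of points is undecidable, so the case split on open servers only yields the
-- invariant under double negation; the final inequality is recovered with an extra 1 in K.

{-# OPTIONS --safe #-}
module Submission where

open import Level using (0ℓ)
open import Function using (_∘_)
open import Data.Bool using (T)
open import Data.Empty using (⊥-elim)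
open import Data.Nat as ℕ using (ℕ; zero; suc; NonZero)
import Data.Nat.Properties as ℕ
open import Data.Integer as ℤ using (ℤ; +_; -[1+_])
import Data.Integer.Properties as ℤ
open import Data.Sign as Sign using (Sign)
open import Data.Fin using (Fin; zero; suc; punchIn; _≟_)
open import Data.Fin.Properties using (punchInᵢ≢i)
open import Data.Fin.Permutation using (Permutation′; _⟨$⟩ʳ_; _⟨$⟩ˡ_; inverseʳ)
import Data.Maybe as Maybe
open import Data.Product using (Σ; ∃; _,_; proj₁; proj₂)
open import Data.Sum using (_⊎_; inj₁; inj₂)
open import Data.Vec using (Vec)
open import Data.Vec.Functional using (removeAt)
open import Effect.Monad using (RawMonad)
open import Relation.Nullary using (¬_; yes; no)
open import Relation.Nullary.Decidable using (isYes)
open import Relation.Nullary.Negation using (¬¬-map; ¬¬-Monad; contradiction)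
open import Relation.Binary.Bundles using (Poset)
open import Relation.Binary.Structures using (IsTotalOrder)
open import Relation.Binary.PropositionalEquality as ≡ using (_≡_; _≢_)
open import Algebra.Bundles using (CommutativeRing)
open import Tactic.RingSolver.Core.AlmostCommutativeRing
  using (AlmostCommutativeRing; _-Raw-AlmostCommutative⟶_; fromCommutativeRing)
open import Tactic.RingSolver.Core.Polynomial.Parameters using (Homomorphism)
open import Defs

-- The library's solvers do not decide identities over an abstract commutative ring: the
-- reflective one takes its coefficients from the ring itself, whose zero cannot be tested, and
-- the Horner forms of Algebra.Solver.Ring are unique only up to computation in the carrier.
-- Integer coefficients, with an exact zero test, make the sparse normal forms canonical.
module IntegerCoefficientSolver (R : CommutativeRing 0ℓ 0ℓ) where
  open CommutativeRing R
  open import Algebra.Properties.Ring ring using (-‿involutive; -0#≈0#; -‿distribˡ-*; -‿distribʳ-*; -‿+-comm)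
  open import Algebra.Properties.Semiring.Mult.TCOptimised semiring using (_×_; 1+×; ×-homo-+; ×1-homo-*)
  open import Algebra.Properties.Semiring.Exp.TCOptimised semiring using (^-congˡ)
  open import Relation.Binary.Reasoning.Setoid setoid
  import Algebra.Solver.CommutativeMonoid +-commutativeMonoid as +-Solver

  -- With the optimised multiple, ⟦ + 1 ⟧ℤ reduces to 1#, so Κ (+ 1) can stand for 1# in solver calls.
  ⟦_⟧ℤ : ℤ → Carrier
  ⟦ + n ⟧ℤ      = n × 1#
  ⟦ -[1+ n ] ⟧ℤ = - (suc n × 1#)

  private
    cancel-+ : ∀ a x y → (a + x) - (a + y) ≈ x - y
    cancel-+ a x y = begin
      (a + x) + - (a + y)     ≈⟨ +-congˡ (-‿+-comm a y) ⟨
      (a + x) + (- a + - y)   ≈⟨ solve 4 (λ a x na ny → (a ⊕ x) ⊕ (na ⊕ ny) ⊜ (a ⊕ na) ⊕ (x ⊕ ny)) refl a x (- a) (- y) ⟩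
      (a + - a) + (x + - y)   ≈⟨ +-congʳ (-‿inverseʳ a) ⟩
      0# + (x + - y)          ≈⟨ +-identityˡ _ ⟩
      x + - y                 ∎
      where open +-Solver

  ⊖-homo : ∀ m n → ⟦ m ℤ.⊖ n ⟧ℤ ≈ m × 1# - n × 1#
  ⊖-homo m       zero    = sym (trans (+-congˡ -0#≈0#) (+-identityʳ _))
  ⊖-homo zero    (suc n) = sym (+-identityˡ _)
  ⊖-homo (suc m) (suc n) = begin
    ⟦ suc m ℤ.⊖ suc n ⟧ℤ                ≡⟨ ≡.cong ⟦_⟧ℤ (ℤ.[1+m]⊖[1+n]≡m⊖n m n) ⟩
    ⟦ m ℤ.⊖ n ⟧ℤ                        ≈⟨ ⊖-homo m n ⟩
    m × 1# - n × 1#                     ≈⟨ cancel-+ 1# _ _ ⟨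
    (1# + m × 1#) - (1# + n × 1#)       ≈⟨ +-cong (1+× m 1#) (-‿cong (1+× n 1#)) ⟨
    suc m × 1# - suc n × 1#             ∎

  +-homo : ∀ i j → ⟦ i ℤ.+ j ⟧ℤ ≈ ⟦ i ⟧ℤ + ⟦ j ⟧ℤ
  +-homo (+ m)      (+ n)      = ×-homo-+ 1# m n
  +-homo (+ m)      -[1+ n ]   = ⊖-homo m (suc n)
  +-homo -[1+ m ]   (+ n)      = trans (⊖-homo n (suc m)) (+-comm _ _)
  +-homo -[1+ m ]   -[1+ n ]   = begin
    - (suc (suc (m ℕ.+ n)) × 1#)          ≡⟨ ≡.cong (λ p → - (p × 1#)) (≡.sym (ℕ.+-suc (suc m) n)) ⟩
    - ((suc m ℕ.+ suc n) × 1#)            ≈⟨ -‿cong (×-homo-+ 1# (suc m) (suc n)) ⟩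
    - (suc m × 1# + suc n × 1#)           ≈⟨ -‿+-comm _ _ ⟨
    - (suc m × 1#) + - (suc n × 1#)       ∎

  signed : Sign → Carrier → Carrier
  signed Sign.+ x = x
  signed Sign.- x = - x

  ◃-homo : ∀ s n → ⟦ s ℤ.◃ n ⟧ℤ ≈ signed s (n × 1#)
  ◃-homo Sign.+ zero    = refl
  ◃-homo Sign.- zero    = sym -0#≈0#
  ◃-homo Sign.+ (suc n) = refl
  ◃-homo Sign.- (suc n) = refl

  ⟦⟧ℤ≡signed : ∀ i → ⟦ i ⟧ℤ ≡ signed (ℤ.sign i) (ℤ.∣ i ∣ × 1#)
  ⟦⟧ℤ≡signed (+ n)    = ≡.refl
  ⟦⟧ℤ≡signed -[1+ n ] = ≡.refl

  signed-* : ∀ s t x y → signed (s Sign.* t) (x * y) ≈ signed s x * signed t y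
  signed-* Sign.+ Sign.+ x y = refl
  signed-* Sign.+ Sign.- x y = -‿distribʳ-* x y
  signed-* Sign.- Sign.+ x y = -‿distribˡ-* x y
  signed-* Sign.- Sign.- x y = begin
    x * y           ≈⟨ -‿involutive _ ⟨
    - - (x * y)     ≈⟨ -‿cong (-‿distribˡ-* x y) ⟩
    - (- x * y)     ≈⟨ -‿distribʳ-* (- x) y ⟩
    - x * - y       ∎

  signed-cong : ∀ s {x y} → x ≈ y → signed s x ≈ signed s y
  signed-cong Sign.+ x≈y = x≈y
  signed-cong Sign.- x≈y = -‿cong x≈y

  *-homo : ∀ i j → ⟦ i ℤ.* j ⟧ℤ ≈ ⟦ i ⟧ℤ * ⟦ j ⟧ℤ
  *-homo i j = begin
    ⟦ s ℤ.◃ (m ℕ.* n) ⟧ℤ                      ≈⟨ ◃-homo s (m ℕ.* n) ⟩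
    signed s ((m ℕ.* n) × 1#)                 ≈⟨ signed-cong s (×1-homo-* m n) ⟩
    signed s ((m × 1#) * (n × 1#))            ≈⟨ signed-* (ℤ.sign i) (ℤ.sign j) _ _ ⟩
    signed (ℤ.sign i) (m × 1#) * signed (ℤ.sign j) (n × 1#)
      ≡⟨ ≡.cong₂ _*_ (≡.sym (⟦⟧ℤ≡signed i)) (≡.sym (⟦⟧ℤ≡signed j)) ⟩
    ⟦ i ⟧ℤ * ⟦ j ⟧ℤ                             ∎
    where
    s = ℤ.sign i Sign.* ℤ.sign j
    m = ℤ.∣ i ∣
    n = ℤ.∣ j ∣

  -‿homo : ∀ i → ⟦ ℤ.- i ⟧ℤ ≈ - ⟦ i ⟧ℤ
  -‿homo (+ zero)    = sym -0#≈0#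
  -‿homo (+ suc n)   = refl
  -‿homo -[1+ n ]    = sym (-‿involutive _)

  open import Tactic.RingSolver.Core.Expression public using (Κ; _⊕_; _⊗_; ⊝_)
  open import Tactic.RingSolver.Core.Expression using (Expr; Ι; _⊛_; module Eval)

  almostCommutativeRing : AlmostCommutativeRing 0ℓ 0ℓ
  almostCommutativeRing = fromCommutativeRing R (λ _ → Maybe.nothing)

  ℤ-morphism : ℤ.+-*-rawRing -Raw-AlmostCommutative⟶ almostCommutativeRing
  ℤ-morphism = record
    { ⟦_⟧    = ⟦_⟧ℤ
    ; +-homo = +-homo
    ; *-homo = *-homo
    ; -‿homo = -‿homo
    ; 0-homo = refl
    ; 1-homo = refl
    }

  isZero⇒≈0 : ∀ i → T (isYes (i ℤ.≟ + 0)) → 0# ≈ ⟦ i ⟧ℤ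
  isZero⇒≈0 (+ zero) _ = refl

  homomorphism : Homomorphism 0ℓ 0ℓ 0ℓ 0ℓ
  homomorphism = record
    { from          = record { rawRing = ℤ.+-*-rawRing ; isZero = λ i → isYes (i ℤ.≟ + 0) }
    ; to            = almostCommutativeRing
    ; morphism      = ℤ-morphism
    ; Zero-C⟶Zero-R = isZero⇒≈0
    }

  open Eval rawRing ⟦_⟧ℤ using (⟦_⟧)
  open import Tactic.RingSolver.Core.Polynomial.Base (Homomorphism.from homomorphism)
    using (Poly; κ; ι; _⊞_; _⊠_; ⊟_; _⊡_)
  open import Tactic.RingSolver.Core.Polynomial.Semantics homomorphism renaming (⟦_⟧ to ⟦_⟧ₚ)
  open import Tactic.RingSolver.Core.Polynomial.Homomorphism homomorphism

  normalise : ∀ {n} → Expr ℤ n → Poly n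
  normalise (Κ x)   = κ x
  normalise (Ι x)   = ι x
  normalise (x ⊕ y) = normalise x ⊞ normalise y
  normalise (x ⊗ y) = normalise x ⊠ normalise y
  normalise (⊝ x)   = ⊟ normalise x
  normalise (x ⊛ i) = normalise x ⊡ i

  ⟦_⇓⟧ : ∀ {n} → Expr ℤ n → Vec Carrier n → Carrier
  ⟦ e ⇓⟧ = ⟦ normalise e ⟧ₚ

  normalise-correct : ∀ {n} (e : Expr ℤ n) ρ → ⟦ e ⇓⟧ ρ ≈ ⟦ e ⟧ ρ
  normalise-correct (Κ x)   ρ = κ-hom x ρ
  normalise-correct (Ι x)   ρ = ι-hom x ρ
  normalise-correct (x ⊕ y) ρ =
    trans (⊞-hom (normalise x) (normalise y) ρ) (+-cong (normalise-correct x ρ) (normalise-correct y ρ))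
  normalise-correct (x ⊗ y) ρ =
    trans (⊠-hom (normalise x) (normalise y) ρ) (*-cong (normalise-correct x ρ) (normalise-correct y ρ))
  normalise-correct (⊝ x)   ρ = trans (⊟-hom (normalise x) ρ) (-‿cong (normalise-correct x ρ))
  normalise-correct (x ⊛ i) ρ = trans (⊡-hom (normalise x) i ρ) (^-congˡ i (normalise-correct x ρ))

  open import Relation.Binary.Reflection setoid Ι ⟦_⟧ ⟦_⇓⟧ normalise-correct public using (solve; _⊜_)

  infixl 6 _⊖_
  _⊖_ : ∀ {n} → Expr ℤ n → Expr ℤ n → Expr ℤ n
  x ⊖ y = x ⊕ ⊝ y

module OrderedFieldProperties (F : OrderedField) where
  open OrderedField F renaming (+-mono-≤ to +-monoˡ-≤)

  commutativeRing : CommutativeRing 0ℓ 0ℓ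
  commutativeRing = record { isCommutativeRing = isCommutativeRing }

  open CommutativeRing commutativeRing public
    using (refl; sym; trans; semiring; +-cong; +-congˡ; +-congʳ; +-comm; +-identityˡ; +-identityʳ;
           +-assoc; *-congˡ; -‿cong; zeroʳ)
    renaming (reflexive to ≈-reflexive)
  open IsTotalOrder isTotalOrder public using (total; antisym; reflexive)
    renaming (trans to ≤-trans; refl to ≤-refl)
  open IntegerCoefficientSolver commutativeRing public using (solve; _⊜_; _⊕_; _⊗_; _⊖_; ⊝_; Κ)

  poset : Poset 0ℓ 0ℓ 0ℓ
  poset = record { isPartialOrder = IsTotalOrder.isPartialOrder isTotalOrder }

  open import Relation.Binary.Reasoning.PartialOrder poset

  +-monoʳ-≤ : ∀ {x y} z → x ≤ y → z + x ≤ z + y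
  +-monoʳ-≤ {x} {y} z x≤y = begin
    z + x  ≈⟨ +-comm z x ⟩
    x + z  ≤⟨ +-monoˡ-≤ z x≤y ⟩
    y + z  ≈⟨ +-comm y z ⟩
    z + y  ∎

  +-mono-≤ : ∀ {x y u v} → x ≤ y → u ≤ v → x + u ≤ y + v
  +-mono-≤ {y = y} {u} x≤y u≤v = ≤-trans (+-monoˡ-≤ u x≤y) (+-monoʳ-≤ y u≤v)

  +-nonNeg : ∀ {x y} → 0# ≤ x → 0# ≤ y → 0# ≤ x + y
  +-nonNeg 0≤x 0≤y = ≤-trans (reflexive (sym (+-identityʳ 0#))) (+-mono-≤ 0≤x 0≤y)

  ≤⇒0≤- : ∀ {x y} → x ≤ y → 0# ≤ y - x
  ≤⇒0≤- {x} {y} x≤y = begin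
    0#      ≈⟨ solve 1 (λ x → Κ (+ 0) ⊜ x ⊖ x) refl x ⟩
    x - x   ≤⟨ +-monoˡ-≤ (- x) x≤y ⟩
    y - x   ∎

  0≤-⇒≤ : ∀ {x y} → 0# ≤ y - x → x ≤ y
  0≤-⇒≤ {x} {y} 0≤y-x = begin
    x             ≈⟨ +-identityˡ x ⟨
    0# + x        ≤⟨ +-monoˡ-≤ x 0≤y-x ⟩
    (y - x) + x   ≈⟨ solve 2 (λ x y → (y ⊖ x) ⊕ x ⊜ y) refl x y ⟩
    y             ∎

  ≤-by-difference : ∀ {x y u v} → u ≤ v → v - u ≈ y - x → x ≤ y
  ≤-by-difference u≤v v-u≈y-x = 0≤-⇒≤ (≤-trans (≤⇒0≤- u≤v) (reflexive v-u≈y-x))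

  ≈-by-difference : ∀ {x y u v} → u ≈ v → v - u ≈ y - x → x ≈ y
  ≈-by-difference {x} {y} {u} {v} u≈v v-u≈y-x = begin-equality
    x             ≈⟨ solve 2 (λ x y → x ⊜ y ⊖ (y ⊖ x)) refl x y ⟩
    y - (y - x)   ≈⟨ +-congˡ (-‿cong v-u≈y-x) ⟨
    y - (v - u)   ≈⟨ +-congˡ (-‿cong (+-congˡ (-‿cong u≈v))) ⟩
    y - (v - v)   ≈⟨ solve 2 (λ y v → y ⊖ (v ⊖ v) ⊜ y) refl y v ⟩
    y             ∎

  *-monoʳ-≤-nonNeg : ∀ {c x y} → 0# ≤ c → x ≤ y → c * x ≤ c * y
  *-monoʳ-≤-nonNeg {c} {x} {y} 0≤c x≤y =
    ≤-by-difference (*-nonneg 0≤c (≤⇒0≤- x≤y))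
      (solve 3 (λ c x y → c ⊗ (y ⊖ x) ⊖ Κ (+ 0) ⊜ c ⊗ y ⊖ c ⊗ x) refl c x y)

  0≤1 : 0# ≤ 1#
  0≤1 with total 0# 1#
  ... | inj₁ 0≤1 = 0≤1
  ... | inj₂ 1≤0 = begin
    0#              ≤⟨ *-nonneg 0≤-1 0≤-1 ⟩
    - 1# * - 1#     ≈⟨ solve 0 (⊝ Κ (+ 1) ⊗ ⊝ Κ (+ 1) ⊜ Κ (+ 1)) refl ⟩
    1#              ∎
    where
    0≤-1 : 0# ≤ - 1#
    0≤-1 = ≤-trans (≤⇒0≤- 1≤0) (reflexive (+-identityˡ (- 1#)))

  *-cancelˡ-≤-≥1 : ∀ {c x y} → 1# ≤ c → c * x ≤ c * y → x ≤ y
  *-cancelˡ-≤-≥1 {c} {x} {y} 1≤c cx≤cy with total x y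
  ... | inj₁ x≤y = x≤y
  ... | inj₂ y≤x = ≤-by-difference
    (+-nonNeg (*-nonneg (≤⇒0≤- 1≤c) (≤⇒0≤- y≤x)) (≤⇒0≤- cx≤cy))
    (solve 3 (λ c x y → (c ⊖ Κ (+ 1)) ⊗ (x ⊖ y) ⊕ (c ⊗ y ⊖ c ⊗ x) ⊖ Κ (+ 0) ⊜ y ⊖ x) refl c x y)

  ¬¬≤⇒≤+1 : ∀ {x y} → ¬ ¬ (x ≤ y) → x ≤ y + 1#
  ¬¬≤⇒≤+1 {x} {y} ¬¬x≤y with total x (y + 1#)
  ... | inj₁ x≤y+1 = x≤y+1
  ... | inj₂ y+1≤x = ⊥-elim (¬¬x≤y λ x≤y → 0≉1 (antisym 0≤1 (1≤0 x≤y)))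
    where
    1≤0 : x ≤ y → 1# ≤ 0#
    1≤0 x≤y = ≤-by-difference (≤-trans y+1≤x x≤y)
      (solve 1 (λ y → y ⊖ (y ⊕ Κ (+ 1)) ⊜ Κ (+ 0) ⊖ Κ (+ 1)) refl y)

¬¬-∀-Fin : ∀ {n} {P : Fin n → Set} → (∀ i → ¬ ¬ P i) → ¬ ¬ (∀ i → P i)
¬¬-∀-Fin {zero}  ¬¬P ¬∀P = ¬∀P (λ ())
¬¬-∀-Fin {suc n} ¬¬P ¬∀P =
  ¬¬P zero λ P0 → ¬¬-∀-Fin (¬¬P ∘ suc) λ PS → ¬∀P λ { zero → P0 ; (suc i) → PS i }

module KServerAnalysis (F : OrderedField) (M : PseudoMetric F) (k : ℕ) where
  open OrderedField F renaming (+-mono-≤ to +-monoˡ-≤)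
  open OrderedFieldProperties F
  open PseudoMetric M
  open KServer F M k
  open import Algebra.Properties.Semiring.Sum semiring
    using (sum; sum-cong-≋; ∑-distrib-+; *-distribˡ-sum; sum-permute; sum-remove)
  open import Relation.Binary.Reasoning.PartialOrder poset

  sumFin≡sum : ∀ n (f : Fin n → Carrier) → sumFin n f ≡ sum f
  sumFin≡sum zero    f = ≡.refl
  sumFin≡sum (suc n) f = ≡.cong (_+_ (f zero)) (sumFin≡sum n (f ∘ suc))

  sumFin-cong : ∀ n {f g : Fin n → Carrier} → (∀ j → f j ≈ g j) → sumFin n f ≈ sumFin n g
  sumFin-cong n {f} {g} f≈g rewrite sumFin≡sum n f | sumFin≡sum n g = sum-cong-≋ f≈g

  sumFin-+ : ∀ n (f g : Fin n → Carrier) → sumFin n (λ j → f j + g j) ≈ sumFin n f + sumFin n g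
  sumFin-+ n f g rewrite sumFin≡sum n f | sumFin≡sum n g | sumFin≡sum n (λ j → f j + g j) =
    ∑-distrib-+ f g

  sumFin-* : ∀ n c (f : Fin n → Carrier) → sumFin n (λ j → c * f j) ≈ c * sumFin n f
  sumFin-* n c f rewrite sumFin≡sum n f | sumFin≡sum n (λ j → c * f j) = sym (*-distribˡ-sum c f)

  sumFin-neg : ∀ n (f : Fin n → Carrier) → sumFin n (λ j → - f j) ≈ - sumFin n f
  sumFin-neg zero    f = solve 0 (Κ (+ 0) ⊜ ⊝ Κ (+ 0)) refl
  sumFin-neg (suc n) f = begin-equality
    - f zero + sumFin n (λ j → - f (suc j))   ≈⟨ +-congˡ (sumFin-neg n (f ∘ suc)) ⟩
    - f zero + - sumFin n (f ∘ suc)           ≈⟨ solve 2 (λ x y → ⊝ x ⊕ ⊝ y ⊜ ⊝ (x ⊕ y)) refl _ _ ⟩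
    - sumFin (suc n) f                        ∎

  sumFin-+- : ∀ n (f g h : Fin n → Carrier) →
              sumFin n (λ j → f j + g j - h j) ≈ sumFin n f + sumFin n g - sumFin n h
  sumFin-+- n f g h = trans (sumFin-+ n _ _) (+-cong (sumFin-+ n f g) (sumFin-neg n h))

  sumFin-const : ∀ n c → sumFin n (λ _ → c) ≡ n · c
  sumFin-const zero    c = ≡.refl
  sumFin-const (suc n) c = ≡.cong (_+_ c) (sumFin-const n c)

  sumFin-mono : ∀ n {f g : Fin n → Carrier} → (∀ j → f j ≤ g j) → sumFin n f ≤ sumFin n g
  sumFin-mono zero    f≤g = ≤-refl
  sumFin-mono (suc n) f≤g = +-mono-≤ (f≤g zero) (sumFin-mono n (f≤g ∘ suc))

  sumFin-nonNeg : ∀ n {f : Fin n → Carrier} → (∀ j → 0# ≤ f j) → 0# ≤ sumFin n f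
  sumFin-nonNeg zero    0≤f = ≤-refl
  sumFin-nonNeg (suc n) 0≤f = +-nonNeg (0≤f zero) (sumFin-nonNeg n (0≤f ∘ suc))

  sumFin-permute : ∀ n (f : Fin n → Carrier) (π : Permutation′ n) →
                   sumFin n (λ j → f (π ⟨$⟩ʳ j)) ≈ sumFin n f
  sumFin-permute n f π rewrite sumFin≡sum n f | sumFin≡sum n (λ j → f (π ⟨$⟩ʳ j)) =
    sym (sum-permute f π)

  sumFin-update : ∀ n (f g : Fin n → Carrier) i → (∀ j → j ≢ i → f j ≈ g j) →
                  sumFin n f ≈ sumFin n g - g i + f i
  sumFin-update (suc n) f g i f≈g rewrite sumFin≡sum (suc n) f | sumFin≡sum (suc n) g = begin-equality
    sum f                                ≈⟨ sum-remove f ⟩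
    f i + sum (removeAt f i)             ≈⟨ +-congˡ (sum-cong-≋ (λ j → f≈g (punchIn i j) (punchInᵢ≢i i j))) ⟩
    f i + sum (removeAt g i)             ≈⟨ solve 3 (λ x y z → x ⊕ z ⊜ (y ⊕ z) ⊖ y ⊕ x) refl (f i) (g i) _ ⟩
    (g i + sum (removeAt g i)) - g i + f i   ≈⟨ +-congʳ (+-congʳ (sum-remove g)) ⟨
    sum g - g i + f i                    ∎

  ·≈* : ∀ n x → n · x ≈ (n · 1#) * x
  ·≈* zero    x = sym (solve 1 (λ x → Κ (+ 0) ⊗ x ⊜ Κ (+ 0)) refl x)
  ·≈* (suc n) x = begin-equality
    x + n · x             ≈⟨ +-congˡ (·≈* n x) ⟩
    x + (n · 1#) * x      ≈⟨ solve 2 (λ x m → x ⊕ m ⊗ x ⊜ (Κ (+ 1) ⊕ m) ⊗ x) refl x (n · 1#) ⟩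
    (1# + n · 1#) * x     ∎

  ·1-nonNeg : ∀ n → 0# ≤ n · 1#
  ·1-nonNeg zero    = ≤-refl
  ·1-nonNeg (suc n) = +-nonNeg 0≤1 (·1-nonNeg n)

  κ : Carrier
  κ = k · 1#

  0≤κ+κ : 0# ≤ κ + κ
  0≤κ+κ = +-nonNeg (·1-nonNeg k) (·1-nonNeg k)

  1≤·1 : ∀ n → .{{NonZero n}} → 1# ≤ n · 1#
  1≤·1 (suc n) = begin
    1#              ≈⟨ +-identityʳ 1# ⟨
    1# + 0#         ≤⟨ +-monoʳ-≤ 1# (·1-nonNeg n) ⟩
    1# + n · 1#     ∎

  1≤κ+κ : .{{NonZero k}} → 1# ≤ κ + κ
  1≤κ+κ = begin
    1#          ≤⟨ 1≤·1 k ⟩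
    κ           ≈⟨ +-identityʳ κ ⟨
    κ + 0#      ≤⟨ +-monoʳ-≤ κ (·1-nonNeg k) ⟩
    κ + κ       ∎

  ∑ : (Fin k → Carrier) → Carrier
  ∑ = sumFin k

  ∑-const : ∀ c → ∑ (λ _ → c) ≈ κ * c
  ∑-const c = trans (≈-reflexive (sumFin-const k c)) (·≈* k c)

  d-nonNeg : ∀ x y → 0# ≤ d x y
  d-nonNeg x y with total (d x y) 0#
  ... | inj₂ 0≤dxy = 0≤dxy
  ... | inj₁ dxy≤0 = begin
    0#                ≈⟨ d-refl x ⟨
    d x x             ≤⟨ d-tri x y x ⟩
    d x y + d y x     ≈⟨ +-congˡ (d-sym y x) ⟩
    d x y + d x y     ≤⟨ +-monoˡ-≤ (d x y) dxy≤0 ⟩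
    0# + d x y        ≈⟨ +-identityˡ (d x y) ⟩
    d x y             ∎

  distSum : Config → Point → Carrier
  distSum c x = ∑ λ l → d x (c l)

  gap : Config → Config → Point → Carrier
  gap s a x = distSum a x - distSum s x

  spread : Config → Carrier
  spread s = ∑ λ j → distSum s (s j)

  spread-nonNeg : ∀ s → 0# ≤ spread s
  spread-nonNeg s = sumFin-nonNeg k (λ j → sumFin-nonNeg k (λ l → d-nonNeg (s j) (s l)))

  spread-cong : ∀ {s s'} → (∀ j → s j ≡ s' j) → spread s ≈ spread s'
  spread-cong s≗s' = sumFin-cong k (λ j → sumFin-cong k (λ l → ≈-reflexive (≡.cong₂ d (s≗s' j) (s≗s' l))))

  matchCost-cong : ∀ {s s' a a'} → (∀ j → s j ≡ s' j) → (∀ j → a j ≡ a' j) →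
                   matchCost s a ≈ matchCost s' a'
  matchCost-cong s≗s' a≗a' = sumFin-cong k (λ j → ≈-reflexive (≡.cong₂ d (s≗s' j) (a≗a' j)))

  spread-bound : ∀ s a → κ * spread s ≤ (κ + κ) * ∑ (λ m → distSum a (s m))
  spread-bound s a = begin
    κ * spread s                                     ≈⟨ sumFin-* k κ _ ⟨
    ∑ (λ j → κ * distSum s (s j))                    ≤⟨ sumFin-mono k row ⟩
    ∑ (λ j → κ * distSum a (s j) + ΣA)               ≈⟨ sumFin-+ k _ _ ⟩
    ∑ (λ j → κ * distSum a (s j)) + ∑ (λ _ → ΣA)     ≈⟨ +-cong (sumFin-* k κ _) (∑-const ΣA) ⟩
    κ * ΣA + κ * ΣA                                  ≈⟨ solve 2 (λ κ A → κ ⊗ A ⊕ κ ⊗ A ⊜ (κ ⊕ κ) ⊗ A) refl κ ΣA ⟩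
    (κ + κ) * ΣA                                     ∎
    where
    ΣA : Carrier
    ΣA = ∑ (λ m → distSum a (s m))

    pair : ∀ j l → κ * d (s j) (s l) ≤ distSum a (s j) + distSum a (s l)
    pair j l = begin
      κ * d (s j) (s l)                               ≈⟨ ∑-const _ ⟨
      ∑ (λ _ → d (s j) (s l))                         ≤⟨ sumFin-mono k (λ x → d-tri (s j) (a x) (s l)) ⟩
      ∑ (λ x → d (s j) (a x) + d (a x) (s l))         ≈⟨ sumFin-cong k (λ x → +-congˡ (d-sym (a x) (s l))) ⟩
      ∑ (λ x → d (s j) (a x) + d (s l) (a x))         ≈⟨ sumFin-+ k _ _ ⟩
      distSum a (s j) + distSum a (s l)               ∎

    row : ∀ j → κ * distSum s (s j) ≤ κ * distSum a (s j) + ΣA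
    row j = begin
      κ * distSum s (s j)                             ≈⟨ sumFin-* k κ _ ⟨
      ∑ (λ l → κ * d (s j) (s l))                     ≤⟨ sumFin-mono k (pair j) ⟩
      ∑ (λ l → distSum a (s j) + distSum a (s l))     ≈⟨ sumFin-+ k _ _ ⟩
      ∑ (λ _ → distSum a (s j)) + ΣA                  ≈⟨ +-congʳ (∑-const _) ⟩
      κ * distSum a (s j) + ΣA                        ∎

  distSum-move : ∀ a a' x → distSum a' x ≤ distSum a x + moveCost a a'
  distSum-move a a' x = begin
    ∑ (λ l → d x (a' l))                   ≤⟨ sumFin-mono k (λ l → d-tri x (a l) (a' l)) ⟩
    ∑ (λ l → d x (a l) + d (a l) (a' l))   ≈⟨ sumFin-+ k _ _ ⟩
    distSum a x + moveCost a a'            ∎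

  gap-adversary : ∀ s a a' x → gap s a' x ≤ gap s a x + moveCost a a'
  gap-adversary s a a' x = ≤-by-difference (distSum-move a a' x)
    (solve 4 (λ A' A v H → (A ⊕ v) ⊖ A' ⊜ (A ⊖ H ⊕ v) ⊖ (A' ⊖ H))
      refl (distSum a' x) (distSum a x) (moveCost a a') (distSum s x))

  gap-bound : ∀ s a x → gap s a x ≤ matchCost s a
  gap-bound s a x = ≤-by-difference A≤H+mc
      (solve 3 (λ A H m → (H ⊕ m) ⊖ A ⊜ m ⊖ (A ⊖ H)) refl (distSum a x) (distSum s x) (matchCost s a))
    where
    A≤H+mc : distSum a x ≤ distSum s x + matchCost s a
    A≤H+mc = begin
      ∑ (λ l → d x (a l))                    ≤⟨ sumFin-mono k (λ l → d-tri x (s l) (a l)) ⟩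
      ∑ (λ l → d x (s l) + d (s l) (a l))    ≈⟨ sumFin-+ k _ _ ⟩
      distSum s x + matchCost s a            ∎

  gap-permute : ∀ s a (π : Permutation′ k) x → gap s (λ j → a (π ⟨$⟩ʳ j)) x ≈ gap s a x
  gap-permute s a π x = +-congʳ (sumFin-permute k (λ j → d x (a j)) π)

  -- Term by term, d(s o, b l) - d(s o, s l) = d(r, b l) - d(r, s l) for l ≢ o, while the
  -- term l = o contributes 2 d(s o, r).
  gap-matched : ∀ s b o {r} → b o ≡ r → (∀ l → l ≢ o → b l ≡ s l ⊎ r ≡ s o) →
                gap s b (s o) ≈ gap s b r + (d (s o) r + d (s o) r)
  gap-matched s b o {r} bo≡r closed = ≈-by-difference (sym sums)
      (solve 5 (λ Ar Hso Aso Hr D → (Ar ⊕ Hso) ⊖ (Aso ⊕ Hr ⊖ (D ⊕ D)) ⊜ (Ar ⊖ Hr ⊕ (D ⊕ D)) ⊖ (Aso ⊖ Hso))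
        refl (distSum b r) (distSum s (s o)) (distSum b (s o)) (distSum s r) (d (s o) r))
    where
    f g : Fin k → Carrier
    f l = d r (b l) + d (s o) (s l)
    g l = d (s o) (b l) + d r (s l)

    f≈g : ∀ l → l ≢ o → f l ≈ g l
    f≈g l l≢o with closed l l≢o
    ... | inj₁ bl≡sl rewrite bl≡sl = +-comm _ _
    ... | inj₂ ≡.refl = refl

    go≈2d : g o ≈ d (s o) r + d (s o) r
    go≈2d rewrite bo≡r = +-congˡ (d-sym r (s o))

    fo≈0 : f o ≈ 0#
    fo≈0 rewrite bo≡r = trans (+-cong (d-refl r) (d-refl (s o))) (+-identityʳ 0#)

    sums : distSum b r + distSum s (s o) ≈ distSum b (s o) + distSum s r - (d (s o) r + d (s o) r)
    sums = begin-equality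
      distSum b r + distSum s (s o)   ≈⟨ sumFin-+ k _ _ ⟨
      ∑ f                             ≈⟨ sumFin-update k f g o f≈g ⟩
      ∑ g - g o + f o                 ≈⟨ +-cong (+-cong (sumFin-+ k _ _) (-‿cong go≈2d)) fo≈0 ⟩
      distSum b (s o) + distSum s r - (d (s o) r + d (s o) r) + 0#   ≈⟨ +-identityʳ _ ⟩
      distSum b (s o) + distSum s r - (d (s o) r + d (s o) r)        ∎

  request-gap : ∀ s a {r} → AtMostOneOpen s a → (∃ λ j → a j ≡ r) →
                ∃ λ o → ¬ ¬ (gap s a (s o) ≈ gap s a r + (d (s o) r + d (s o) r))
  request-gap s a {r} (π , _ , atMostOne) (j₀ , aj₀≡r) = o , ¬¬-map matched (¬¬-∀-Fin closed)
    where
    b : Config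
    b l = a (π ⟨$⟩ʳ l)

    o : Fin k
    o = π ⟨$⟩ˡ j₀

    bo≡r : b o ≡ r
    bo≡r = ≡.trans (≡.cong a (inverseʳ π)) aj₀≡r

    closed : ∀ l → ¬ ¬ (l ≢ o → b l ≡ s l ⊎ r ≡ s o)
    closed l ¬closed = l≢o (atMostOne l o (λ bl≡sl → ¬closed (λ _ → inj₁ bl≡sl))
                                          (λ bo≡so → ¬closed (λ _ → inj₂ (≡.trans (≡.sym bo≡r) bo≡so))))
      where
      l≢o : l ≢ o
      l≢o l≡o = ¬closed (λ l≢o → ⊥-elim (l≢o l≡o))

    matched : (∀ l → l ≢ o → b l ≡ s l ⊎ r ≡ s o) → gap s a (s o) ≈ gap s a r + (d (s o) r + d (s o) r)
    matched closed′ = begin-equality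
      gap s a (s o)                          ≈⟨ gap-permute s a π (s o) ⟨
      gap s b (s o)                          ≈⟨ gap-matched s b o bo≡r closed′ ⟩
      gap s b r + (d (s o) r + d (s o) r)    ≈⟨ +-congʳ (gap-permute s a π r) ⟩
      gap s a r + (d (s o) r + d (s o) r)    ∎

  twice : (Fin k → Carrier) → Fin k → Carrier
  twice E j = E j + E j

  -- The handicap argument e is always twice E, the form in which HandicapStep states the update.
  basePotential : Config → (Fin k → Carrier) → Carrier
  basePotential s e = spread s - (∑ e + ∑ e)

  handicapGap : Config → (Fin k → Carrier) → Config → Fin k → Carrier
  handicapGap s e a m = e m + gap s a (s m)

  potential : Config → (Fin k → Carrier) → Config → Fin k → Carrier
  potential s e a m = basePotential s e + (κ + κ) * handicapGap s e a m

  potential-sum : ∀ s e a → ∑ (potential s e a) ≈ (κ + κ) * ∑ (λ m → distSum a (s m)) - κ * spread s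
  potential-sum s e a = begin-equality
    ∑ (potential s e a)
      ≈⟨ sumFin-+ k _ _ ⟩
    ∑ (λ _ → basePotential s e) + ∑ (λ m → (κ + κ) * handicapGap s e a m)
      ≈⟨ +-cong (∑-const _) (sumFin-* k (κ + κ) _) ⟩
    κ * basePotential s e + (κ + κ) * ∑ (handicapGap s e a)
      ≈⟨ +-congˡ (*-congˡ gaps) ⟩
    κ * basePotential s e + (κ + κ) * (∑ e + (ΣA - spread s))
      ≈⟨ solve 4 (λ κ D S A → κ ⊗ (D ⊖ (S ⊕ S)) ⊕ (κ ⊕ κ) ⊗ (S ⊕ (A ⊖ D)) ⊜ (κ ⊕ κ) ⊗ A ⊖ κ ⊗ D)
           refl κ (spread s) (∑ e) ΣA ⟩
    (κ + κ) * ΣA - κ * spread s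
      ∎
    where
    ΣA : Carrier
    ΣA = ∑ (λ m → distSum a (s m))

    gaps : ∑ (handicapGap s e a) ≈ ∑ e + (ΣA - spread s)
    gaps = begin-equality
      ∑ (handicapGap s e a)                  ≈⟨ sumFin-+ k _ _ ⟩
      ∑ e + ∑ (λ m → gap s a (s m))          ≈⟨ +-congˡ (sumFin-+ k _ _) ⟩
      ∑ e + (ΣA + ∑ (λ m → - distSum s (s m)))   ≈⟨ +-congˡ (+-congˡ (sumFin-neg k _)) ⟩
      ∑ e + (ΣA - spread s)                  ∎

  potential-sum-nonNeg : ∀ s e a → 0# ≤ ∑ (potential s e a)
  potential-sum-nonNeg s e a = ≤-trans (≤⇒0≤- (spread-bound s a)) (reflexive (sym (potential-sum s e a)))

  potential-adversary : ∀ s e a a' m → potential s e a' m ≤ potential s e a m + (κ + κ) * moveCost a a'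
  potential-adversary s e a a' m = begin
    basePotential s e + (κ + κ) * (e m + gap s a' (s m))
      ≤⟨ +-monoʳ-≤ _ (*-monoʳ-≤-nonNeg 0≤κ+κ (+-monoʳ-≤ (e m) (gap-adversary s a a' (s m)))) ⟩
    basePotential s e + (κ + κ) * (e m + (gap s a (s m) + moveCost a a'))
      ≈⟨ solve 5 (λ B κ t g v → B ⊕ (κ ⊕ κ) ⊗ (t ⊕ (g ⊕ v)) ⊜ B ⊕ (κ ⊕ κ) ⊗ (t ⊕ g) ⊕ (κ ⊕ κ) ⊗ v)
           refl (basePotential s e) κ (e m) (gap s a (s m)) (moveCost a a') ⟩
    potential s e a m + (κ + κ) * moveCost a a'
      ∎

  module HandicapMove {s E r i s' E'} (step : HandicapStep s E r i s' E') where
    e e' : Fin k → Carrier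
    e  = twice E
    e' = twice E'

    c : Carrier
    c = d (s i) r

    greedy : ∀ j → E i + d (s i) r ≤ E j + d (s j) r
    greedy = proj₁ step

    e'-update : ∀ j → e' j ≈ e j + (d r (s i) + d r (s j) - d (s i) (s j))
    e'-update = proj₁ (proj₂ step)

    moved : s' i ≡ r
    moved = proj₁ (proj₂ (proj₂ step))

    unmoved : ∀ j → j ≢ i → s' j ≡ s j
    unmoved = proj₂ (proj₂ (proj₂ step))

    choice : ∀ j → e i + (c + c) ≤ e j + (d (s j) r + d (s j) r)
    choice j = ≤-by-difference (+-mono-≤ (greedy j) (greedy j))
      (solve 4 (λ Ei c Ej dj → (Ej ⊕ dj) ⊕ (Ej ⊕ dj) ⊖ ((Ei ⊕ c) ⊕ (Ei ⊕ c))
                               ⊜ (Ej ⊕ Ej ⊕ (dj ⊕ dj)) ⊖ (Ei ⊕ Ei ⊕ (c ⊕ c)))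
        refl (E i) c (E j) (d (s j) r))

    moveCost-step : moveCost s s' ≈ c
    moveCost-step = begin-equality
      ∑ (λ j → d (s j) (s' j))             ≈⟨ sumFin-update k _ (λ _ → 0#) i stay ⟩
      ∑ (λ _ → 0#) - 0# + d (s i) (s' i)   ≈⟨ +-congʳ (+-congʳ (∑-const 0#)) ⟩
      κ * 0# - 0# + d (s i) (s' i)         ≈⟨ solve 2 (λ κ x → κ ⊗ Κ (+ 0) ⊖ Κ (+ 0) ⊕ x ⊜ x) refl κ _ ⟩
      d (s i) (s' i)                       ≡⟨ ≡.cong (d (s i)) moved ⟩
      c                                    ∎
      where
      stay : ∀ j → j ≢ i → d (s j) (s' j) ≈ 0#
      stay j j≢i = trans (≈-reflexive (≡.cong (d (s j)) (unmoved j j≢i))) (d-refl (s j))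

    distSum-after : ∀ x → distSum s' x ≈ distSum s x + d x r - d x (s i)
    distSum-after x = begin-equality
      distSum s' x
        ≈⟨ sumFin-update k _ _ i (λ j j≢i → ≈-reflexive (≡.cong (d x) (unmoved j j≢i))) ⟩
      distSum s x - d x (s i) + d x (s' i)
        ≡⟨ ≡.cong (λ y → distSum s x - d x (s i) + d x y) moved ⟩
      distSum s x - d x (s i) + d x r
        ≈⟨ solve 3 (λ H a b → H ⊖ a ⊕ b ⊜ H ⊕ b ⊖ a) refl _ _ _ ⟩
      distSum s x + d x r - d x (s i)
        ∎

    spread-after : spread s' ≈ spread s + (distSum s r + distSum s r)
                                        - (distSum s (s i) + distSum s (s i)) - (c + c)
    spread-after = begin-equality
      ∑ (λ j → distSum s' (s' j))
        ≈⟨ sumFin-update k _ (λ j → distSum s' (s j)) i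
             (λ j j≢i → ≈-reflexive (≡.cong (distSum s') (unmoved j j≢i))) ⟩
      ∑ (λ j → distSum s' (s j)) - distSum s' (s i) + distSum s' (s' i)
        ≡⟨ ≡.cong (λ y → ∑ (λ j → distSum s' (s j)) - distSum s' (s i) + distSum s' y) moved ⟩
      ∑ (λ j → distSum s' (s j)) - distSum s' (s i) + distSum s' r
        ≈⟨ +-cong (+-cong column (-‿cong atMoved)) atRequest ⟩
      (spread s + H r - H (s i)) - (H (s i) + c - 0#) + (H r + 0# - c)
        ≈⟨ solve 4 (λ S Hr Hsi c → (S ⊕ Hr ⊖ Hsi) ⊖ (Hsi ⊕ c ⊖ Κ (+ 0)) ⊕ (Hr ⊕ Κ (+ 0) ⊖ c)
                                   ⊜ S ⊕ (Hr ⊕ Hr) ⊖ (Hsi ⊕ Hsi) ⊖ (c ⊕ c))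
             refl (spread s) (H r) (H (s i)) c ⟩
      spread s + (H r + H r) - (H (s i) + H (s i)) - (c + c)
        ∎
      where
      H : Point → Carrier
      H = distSum s

      column : ∑ (λ j → distSum s' (s j)) ≈ spread s + H r - H (s i)
      column = begin-equality
        ∑ (λ j → distSum s' (s j))
          ≈⟨ sumFin-cong k (λ j → distSum-after (s j)) ⟩
        ∑ (λ j → H (s j) + d (s j) r - d (s j) (s i))
          ≈⟨ sumFin-+- k _ _ _ ⟩
        spread s + ∑ (λ j → d (s j) r) - ∑ (λ j → d (s j) (s i))
          ≈⟨ +-cong (+-congˡ (sumFin-cong k (λ j → d-sym (s j) r)))
                    (-‿cong (sumFin-cong k (λ j → d-sym (s j) (s i)))) ⟩
        spread s + H r - H (s i)
          ∎

      atMoved : distSum s' (s i) ≈ H (s i) + c - 0#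
      atMoved = trans (distSum-after (s i)) (+-congˡ (-‿cong (d-refl (s i))))

      atRequest : distSum s' r ≈ H r + 0# - c
      atRequest = trans (distSum-after r) (+-cong (+-congˡ (d-refl r)) (-‿cong (d-sym r (s i))))

    handicapSum-after : ∑ e' ≈ ∑ e + (κ * c + distSum s r - distSum s (s i))
    handicapSum-after = begin-equality
      ∑ e'
        ≈⟨ sumFin-cong k e'-update ⟩
      ∑ (λ j → e j + (d r (s i) + d r (s j) - d (s i) (s j)))
        ≈⟨ sumFin-+ k _ _ ⟩
      ∑ e + ∑ (λ j → d r (s i) + d r (s j) - d (s i) (s j))
        ≈⟨ +-congˡ (sumFin-+- k _ _ _) ⟩
      ∑ e + (∑ (λ _ → d r (s i)) + distSum s r - distSum s (s i))
        ≈⟨ +-congˡ (+-congʳ (+-congʳ (trans (∑-const _) (*-congˡ (d-sym r (s i)))))) ⟩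
      ∑ e + (κ * c + distSum s r - distSum s (s i))
        ∎

    basePotential-after : basePotential s' e' + (c + c) + (κ + κ) * c ≈ basePotential s e
    basePotential-after = begin-equality
      spread s' - (∑ e' + ∑ e') + (c + c) + (κ + κ) * c
        ≈⟨ +-congʳ (+-congʳ (+-cong spread-after (-‿cong (+-cong handicapSum-after handicapSum-after)))) ⟩
      spread s + (Hr + Hr) - (Hsi + Hsi) - (c + c)
        - ((∑ e + (κ * c + Hr - Hsi)) + (∑ e + (κ * c + Hr - Hsi))) + (c + c) + (κ + κ) * c
        ≈⟨ solve 6 (λ S Hr Hsi c Σe κ →
              S ⊕ (Hr ⊕ Hr) ⊖ (Hsi ⊕ Hsi) ⊖ (c ⊕ c)
                ⊖ ((Σe ⊕ (κ ⊗ c ⊕ Hr ⊖ Hsi)) ⊕ (Σe ⊕ (κ ⊗ c ⊕ Hr ⊖ Hsi))) ⊕ (c ⊕ c) ⊕ (κ ⊕ κ) ⊗ c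
              ⊜ S ⊖ (Σe ⊕ Σe))
             refl (spread s) Hr Hsi c (∑ e) κ ⟩
      spread s - (∑ e + ∑ e)
        ∎
      where
      Hr Hsi : Carrier
      Hr  = distSum s r
      Hsi = distSum s (s i)

    gap-after : ∀ a x → gap s' a x ≈ gap s a x + d x (s i) - d x r
    gap-after a x = begin-equality
      distSum a x - distSum s' x
        ≈⟨ +-congˡ (-‿cong (distSum-after x)) ⟩
      distSum a x - (distSum s x + d x r - d x (s i))
        ≈⟨ solve 4 (λ A H p q → A ⊖ (H ⊕ q ⊖ p) ⊜ A ⊖ H ⊕ p ⊖ q) refl (distSum a x) (distSum s x) (d x (s i)) (d x r) ⟩
      gap s a x + d x (s i) - d x r
        ∎

    handicapGap-unmoved : ∀ a j → j ≢ i → handicapGap s' e' a j ≈ c + handicapGap s e a j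
    handicapGap-unmoved a j j≢i = begin-equality
      e' j + gap s' a (s' j)
        ≡⟨ ≡.cong (λ y → e' j + gap s' a y) (unmoved j j≢i) ⟩
      e' j + gap s' a (s j)
        ≈⟨ +-cong (e'-update j) (gap-after a (s j)) ⟩
      e j + (d r (s i) + d r (s j) - d (s i) (s j)) + (gap s a (s j) + d (s j) (s i) - d (s j) r)
        ≈⟨ +-congˡ (+-cong (+-congˡ (d-sym (s j) (s i))) (-‿cong (d-sym (s j) r))) ⟩
      e j + (d r (s i) + d r (s j) - d (s i) (s j)) + (gap s a (s j) + d (s i) (s j) - d r (s j))
        ≈⟨ solve 5 (λ t c' p q g → t ⊕ (c' ⊕ p ⊖ q) ⊕ (g ⊕ q ⊖ p) ⊜ c' ⊕ (t ⊕ g))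
             refl (e j) (d r (s i)) (d r (s j)) (d (s i) (s j)) (gap s a (s j)) ⟩
      d r (s i) + (e j + gap s a (s j))
        ≈⟨ +-congʳ (d-sym r (s i)) ⟩
      c + handicapGap s e a j
        ∎

    handicapGap-moved : ∀ a → handicapGap s' e' a i ≈ c + (e i + (c + c) + gap s a r)
    handicapGap-moved a = begin-equality
      e' i + gap s' a (s' i)
        ≡⟨ ≡.cong (λ y → e' i + gap s' a y) moved ⟩
      e' i + gap s' a r
        ≈⟨ +-cong (e'-update i) (gap-after a r) ⟩
      e i + (d r (s i) + d r (s i) - d (s i) (s i)) + (gap s a r + d r (s i) - d r r)
        ≈⟨ +-cong (+-congˡ (+-cong (+-cong c'≈c c'≈c) (-‿cong (d-refl (s i)))))
                  (+-cong (+-congˡ c'≈c) (-‿cong (d-refl r))) ⟩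
      e i + (c + c - 0#) + (gap s a r + c - 0#)
        ≈⟨ solve 3 (λ t c g → t ⊕ (c ⊕ c ⊖ Κ (+ 0)) ⊕ (g ⊕ c ⊖ Κ (+ 0)) ⊜ c ⊕ (t ⊕ (c ⊕ c) ⊕ g))
             refl (e i) c (gap s a r) ⟩
      c + (e i + (c + c) + gap s a r)
        ∎
      where
      c'≈c : d r (s i) ≈ c
      c'≈c = d-sym r (s i)

    handicapGap-dominated : ∀ a → AtMostOneOpen s a → (∃ λ j → a j ≡ r) →
                            ∀ m → ¬ ¬ (∃ λ m' → handicapGap s' e' a m ≤ c + handicapGap s e a m')
    handicapGap-dominated a oneOpen served m with m ≟ i
    ... | no m≢i     = contradiction (m , reflexive (handicapGap-unmoved a m m≢i))
    ... | yes ≡.refl with request-gap s a oneOpen served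
    ...   | o , ¬¬gap≈ = ¬¬-map (λ gap≈ → o , dominated gap≈) ¬¬gap≈
      where
      dominated : gap s a (s o) ≈ gap s a r + (d (s o) r + d (s o) r) →
                  handicapGap s' e' a i ≤ c + handicapGap s e a o
      dominated gap≈ = begin
        handicapGap s' e' a i                          ≈⟨ handicapGap-moved a ⟩
        c + (e i + (c + c) + gap s a r)                ≤⟨ +-monoʳ-≤ c (+-monoˡ-≤ (gap s a r) (choice o)) ⟩
        c + (e o + (d (s o) r + d (s o) r) + gap s a r)
          ≈⟨ +-congˡ (solve 3 (λ t g D → t ⊕ D ⊕ g ⊜ t ⊕ (g ⊕ D)) refl (e o) (gap s a r) _) ⟩
        c + (e o + (gap s a r + (d (s o) r + d (s o) r)))  ≈⟨ +-congˡ (+-congˡ gap≈) ⟨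
        c + handicapGap s e a o                         ∎

    potential-after : ∀ a {m m'} → handicapGap s' e' a m ≤ c + handicapGap s e a m' →
                      potential s' e' a m + (c + c) ≤ potential s e a m'
    potential-after a {m} {m'} dominated = begin
      basePotential s' e' + (κ + κ) * handicapGap s' e' a m + (c + c)
        ≤⟨ +-monoˡ-≤ (c + c) (+-monoʳ-≤ _ (*-monoʳ-≤-nonNeg 0≤κ+κ dominated)) ⟩
      basePotential s' e' + (κ + κ) * (c + handicapGap s e a m') + (c + c)
        ≈⟨ solve 4 (λ B κ c t → B ⊕ (κ ⊕ κ) ⊗ (c ⊕ t) ⊕ (c ⊕ c) ⊜ B ⊕ (c ⊕ c) ⊕ (κ ⊕ κ) ⊗ c ⊕ (κ ⊕ κ) ⊗ t)
             refl (basePotential s' e') κ c (handicapGap s e a m') ⟩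
      basePotential s' e' + (c + c) + (κ + κ) * c + (κ + κ) * handicapGap s e a m'
        ≈⟨ +-congʳ basePotential-after ⟩
      potential s e a m'
        ∎

  additiveConstant : Config → Config → Carrier
  additiveConstant s₀ a₀ = spread s₀ + κ * matchCost s₀ a₀

  module Amortisation {n s₀ a₀} (ρ : Run n s₀ a₀) where
    open Run ρ hiding (c)
    open RawMonad (¬¬-Monad {0ℓ}) using (_>>=_; pure)

    algCost advCost : ℕ → Carrier
    algCost t = sumℕ t (λ u → moveCost (s u) (s (suc u)))
    advCost t = sumℕ t (λ u → moveCost (a u) (a (suc u)))

    K : Carrier
    K = additiveConstant s₀ a₀

    Invariant : ℕ → Set
    Invariant t = ∀ m → ¬ ¬ (algCost t + algCost t + potential (s t) (twice (E t)) (a t) m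
                             ≤ (κ * advCost t + K) + (κ * advCost t + K))

    invariant-init : Invariant 0
    invariant-init m = pure (begin
      0# + 0# + (spread (s 0) - (∑ e₀ + ∑ e₀) + (κ + κ) * (e₀ m + gap (s 0) (a 0) (s 0 m)))
        ≤⟨ +-monoʳ-≤ _ (+-monoʳ-≤ _ (*-monoʳ-≤-nonNeg 0≤κ+κ (+-monoʳ-≤ _ (gap-bound (s 0) (a 0) (s 0 m))))) ⟩
      0# + 0# + (spread (s 0) - (∑ e₀ + ∑ e₀) + (κ + κ) * (e₀ m + matchCost (s 0) (a 0)))
        ≈⟨ +-congˡ (+-cong (+-cong (spread-cong s-init) (-‿cong (+-cong ∑e₀≈0 ∑e₀≈0)))
                          (*-congˡ (+-cong (e₀≈0 m) (matchCost-cong s-init a-init)))) ⟩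
      0# + 0# + (spread s₀ - (0# + 0#) + (κ + κ) * (0# + matchCost s₀ a₀))
        ≤⟨ ≤-by-difference (spread-nonNeg s₀)
             (solve 3 (λ S κ mc → S ⊖ Κ (+ 0)
                ⊜ (κ ⊗ Κ (+ 0) ⊕ (S ⊕ κ ⊗ mc)) ⊕ (κ ⊗ Κ (+ 0) ⊕ (S ⊕ κ ⊗ mc))
                  ⊖ (Κ (+ 0) ⊕ Κ (+ 0) ⊕ (S ⊖ (Κ (+ 0) ⊕ Κ (+ 0)) ⊕ (κ ⊕ κ) ⊗ (Κ (+ 0) ⊕ mc))))
               refl (spread s₀) κ (matchCost s₀ a₀)) ⟩
      (κ * 0# + K) + (κ * 0# + K)
        ∎)
      where
      e₀ : Fin k → Carrier
      e₀ = twice (E 0)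

      e₀≈0 : ∀ j → e₀ j ≈ 0#
      e₀≈0 j = trans (+-cong (E-init j) (E-init j)) (+-identityʳ 0#)

      ∑e₀≈0 : ∑ e₀ ≈ 0#
      ∑e₀≈0 = trans (sumFin-cong k e₀≈0) (trans (∑-const 0#) (zeroʳ κ))

    amortise : ∀ {CA c P′ P CV v} → P′ + (c + c) ≤ P + (κ + κ) * v →
               CA + CA + P ≤ (κ * CV + K) + (κ * CV + K) →
               (CA + c) + (CA + c) + P′ ≤ (κ * (CV + v) + K) + (κ * (CV + v) + K)
    amortise {CA} {c} {P′} {P} {CV} {v} step before = ≤-by-difference (+-mono-≤ step before)
      (solve 8 (λ CA c P′ P CV v κ K →
          (P ⊕ (κ ⊕ κ) ⊗ v) ⊕ ((κ ⊗ CV ⊕ K) ⊕ (κ ⊗ CV ⊕ K)) ⊖ ((P′ ⊕ (c ⊕ c)) ⊕ (CA ⊕ CA ⊕ P))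
        ⊜ ((κ ⊗ (CV ⊕ v) ⊕ K) ⊕ (κ ⊗ (CV ⊕ v) ⊕ K)) ⊖ ((CA ⊕ c) ⊕ (CA ⊕ c) ⊕ P′))
        refl CA c P′ P CV v κ K)

    invariant-step : ∀ t → t ℕ.< n → Invariant t → Invariant (suc t)
    invariant-step t t<n before m = do
      (m' , dominated) ← handicapGap-dominated (a (suc t)) (open-between t t<n) (adv-serves t t<n) m
      bound ← before m'
      pure (amortise (begin
        potential (s (suc t)) e' (a (suc t)) m + (mc + mc)
          ≈⟨ +-congˡ (+-cong moveCost-step moveCost-step) ⟩
        potential (s (suc t)) e' (a (suc t)) m + (c + c)
          ≤⟨ potential-after (a (suc t)) dominated ⟩
        potential (s t) e (a (suc t)) m'
          ≤⟨ potential-adversary (s t) e (a t) (a (suc t)) m' ⟩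
        potential (s t) e (a t) m' + (κ + κ) * moveCost (a t) (a (suc t))
          ∎) bound)
      where
      open HandicapMove (handicap t t<n)

      mc : Carrier
      mc = moveCost (s t) (s (suc t))

    invariant : ∀ t → t ℕ.≤ n → Invariant t
    invariant zero    _   = invariant-init
    invariant (suc t) t<n = invariant-step t t<n (invariant t (ℕ.<⇒≤ t<n))

    costAlg-bound : .{{NonZero k}} → ¬ ¬ (costAlg ≤ κ * costAdv + K)
    costAlg-bound = ¬¬-map average (¬¬-∀-Fin (invariant n ℕ.≤-refl))
      where
      W : Carrier
      W = κ * costAdv + K

      average : (∀ m → costAlg + costAlg + potential (s n) (twice (E n)) (a n) m ≤ W + W) → costAlg ≤ W
      average bound = *-cancelˡ-≤-≥1 1≤κ+κ (begin
        (κ + κ) * costAlg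
          ≈⟨ solve 2 (λ κ x → (κ ⊕ κ) ⊗ x ⊜ κ ⊗ (x ⊕ x) ⊕ Κ (+ 0)) refl κ costAlg ⟩
        κ * (costAlg + costAlg) + 0#
          ≤⟨ +-monoʳ-≤ _ (potential-sum-nonNeg (s n) (twice (E n)) (a n)) ⟩
        κ * (costAlg + costAlg) + ∑ (potential (s n) (twice (E n)) (a n))
          ≈⟨ trans (sumFin-+ k _ _) (+-congʳ (∑-const _)) ⟨
        ∑ (λ m → costAlg + costAlg + potential (s n) (twice (E n)) (a n) m)
          ≤⟨ sumFin-mono k bound ⟩
        ∑ (λ _ → W + W)
          ≈⟨ ∑-const (W + W) ⟩
        κ * (W + W)
          ≈⟨ solve 2 (λ κ x → κ ⊗ (x ⊕ x) ⊜ (κ ⊕ κ) ⊗ x) refl κ W ⟩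
        (κ + κ) * W
          ∎)

theorem3 : (F : OrderedField) (M : PseudoMetric F) (k : ℕ) → NonZero k →
    let open OrderedField F
        open KServer F M k
    in (s₀ a₀ : Config) → Σ Carrier λ K →
         (n : ℕ) (ρ : Run n s₀ a₀) →
           Run.costAlg ρ ≤ (k · Run.costAdv ρ) + K
theorem3 F M k nonZero s₀ a₀ = additiveConstant s₀ a₀ + 1# , bound
  where
  open OrderedField F
  open OrderedFieldProperties F
  open KServer F M k
  open KServerAnalysis F M k
  open import Relation.Binary.Reasoning.PartialOrder poset

  bound : (n : ℕ) (ρ : Run n s₀ a₀) → Run.costAlg ρ ≤ (k · Run.costAdv ρ) + (additiveConstant s₀ a₀ + 1#)
  bound n ρ = begin
    Run.costAlg ρ                     ≤⟨ ¬¬≤⇒≤+1 (costAlg-bound {{nonZero}}) ⟩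
    κ * Run.costAdv ρ + K + 1#        ≈⟨ +-assoc _ K 1# ⟩
    κ * Run.costAdv ρ + (K + 1#)      ≈⟨ +-congʳ (·≈* k (Run.costAdv ρ)) ⟨
    k · Run.costAdv ρ + (K + 1#)      ∎
    where open Amortisation ρ
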